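{- Let $f$ be as defined in the context. Then: (1) $f(N,1)=0$ for all $N\ge1$; (2) $f(N+1,\Delta)\geq f(N,\Delta)+1$ for $N\geq\Delta\geq 2$; (3) $f(N,\Delta+1)\geq f(N,\Delta)+1$ for $\Delta\ge1$ and $N>\binom{\Delta+1}{2}$; (4) for $\Delta+1\le N$: if $\Delta>\frac{N}{2}$ then $f(N,\Delta+1)\geq f(N,\Delta)$, and if $\Delta>\left\lceil\frac{N}{2}\right\rceil$ then $f(N,\Delta+1)\geq f(N,\Delta)+1$.
   Context: All graphs are finite and simple; $L(G)$ is the line graph, so $e(L(G))=\sum_v\binom{\deg(v)}{2}$. For integers $N\ge\Delta\ge1$, $f(N,\Delta)=\max\{e(L(G)) : e(G)=N,\ \Delta(G)=\Delta,\ \delta(G)\geq1\}$, where $\Delta(G),\delta(G)$ are maximum and minimum degree. -}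

module Defs where

open import Data.Nat using (ℕ; zero; suc; _+_; _≤_; _<_; _⊔_)
open import Data.Nat.Combinatorics using (_C_)
open import Data.Fin using (Fin; _≟_) renaming (_<_ to _<ᶠ_)
open import Data.Fin.Properties using ()
open import Data.List using (List; []; _∷_; length; map; foldr; allFin)
open import Data.Nat.ListAction using (sum)
open import Data.List.Relation.Unary.All using (All)
open import Data.List.Relation.Unary.Unique.Propositional using (Unique)
open import Data.Product using (_×_; _,_; proj₁; proj₂; ∃)
open import Relation.Binary.PropositionalEquality using (_≡_)
open import Relation.Nullary using (yes; no)

-- A finite simple graph: vertex set Fin n, edges a duplicate-free list of
-- pairs (i , j) with i < j (so no loops, no multi-edges).
record Graph : Set where
  field
    n       : ℕ
    edges   : List (Fin n × Fin n)
    ordered : All (λ e → proj₁ e <ᶠ proj₂ e) edges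
    unique  : Unique edges
open Graph public

numEdges : Graph → ℕ
numEdges G = length (edges G)

incident : ∀ {n} → Fin n → List (Fin n × Fin n) → ℕ
incident v [] = 0
incident v ((a , b) ∷ es) with v ≟ a | v ≟ b
... | yes _ | _     = suc (incident v es)
... | no _  | yes _ = suc (incident v es)
... | no _  | no _  = incident v es

deg : (G : Graph) → Fin (n G) → ℕ
deg G v = incident v (edges G)

-- maximum degree Δ(G) (0 for the graph with no vertices)
maxDeg : Graph → ℕ
maxDeg G = foldr _⊔_ 0 (map (deg G) (allFin (n G)))

minDegPos : Graph → Set
minDegPos G = ∀ v → 1 ≤ deg G v

-- e(L(G)) = Σ_v C(deg v, 2)
lineEdges : Graph → ℕ
lineEdges G = sum (map (λ v → deg G v C 2) (allFin (n G)))

Admissible : ℕ → ℕ → Graph → Set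
Admissible N Δ G = (numEdges G ≡ N) × (maxDeg G ≡ Δ) × minDegPos G

-- "f(N, Δ) = m": m is the maximum of e(L(G)) over admissible G
-- (attained, and an upper bound).
IsF : ℕ → ℕ → ℕ → Set
IsF N Δ m = (∃ λ G → Admissible N Δ G × (lineEdges G ≡ m))
          × (∀ G → Admissible N Δ G → lineEdges G ≤ m)

{-# OPTIONS --safe #-}

-- Everything is driven by degrees: e(L(G)) = Σ_v C(deg v, 2), and putting an edge ab into a
-- graph raises it by deg a + deg b.  (1) For Δ = 1 all these binomials vanish, and a perfect
-- matching attains 0.  Parts (2)-(4) transform an optimal graph G for f(N, Δ), with a vertex v
-- of degree Δ, and finally delete the vertices left isolated.
-- (2) Subdividing an edge keeps every old degree and adds a vertex of degree 2 ≤ Δ, so the line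
--     graph gains exactly one edge.
-- (3) If v were adjacent to all other vertices, G would have at most Δ + 1 vertices and hence at
--     most C(Δ+1, 2) edges.  So some x is not adjacent to v; replacing an edge xy by xv makes
--     deg v = Δ + 1 and changes e(L) by Δ - (deg y - 1) ≥ 1.
-- (4) As Δ < N some edge ab misses v; replacing it by a pendant edge at v makes deg v = Δ + 1.
--     In G - ab an edge is counted twice in deg a + deg b + deg v only if it is av or bv, so
--     this sum is at most N + 1 and e(L) changes by at least Δ - (N + 1 - Δ) = 2Δ - N - 1.
module Submission where

open import Defs
open import Data.Nat using (ℕ; zero; suc; _+_; _*_; _≤_; _<_; _≥_; ⌊_/2⌋; ⌈_/2⌉; _⊔_; z≤n; s≤s; s≤s⁻¹)
open import Data.Nat.Properties
open import Data.Nat.Solver using (module +-*-Solver)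
open import Data.Nat.Combinatorics using (_C_; nC1≡n; nCk+nC[k+1]≡[n+1]C[k+1])
open import Data.Nat.ListAction using (sum)
open import Data.Bool using (if_then_else_)
open import Data.Product using (_×_; _,_; proj₁; proj₂; ∃)
open import Data.Sum using (_⊎_; inj₁; inj₂)
open import Data.Fin as Fin using (Fin; zero; suc; punchIn; punchOut) renaming (_<_ to _<ᶠ_)
import Data.Fin.Properties as Fin
open import Data.List using (List; []; _∷_; _++_; length; map; foldr; allFin; tabulate)
open import Data.List.Relation.Unary.All as All using (All; []; _∷_)
open import Data.List.Relation.Unary.Any using (here; there)
open import Data.List.Membership.Propositional using (_∈_)
open import Data.List.Membership.Propositional.Properties using (∈-∃++)
open import Data.List.Relation.Binary.Permutation.Propositional using (_↭_; ↭-sym; ↭⇒↭ₛ)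
import Data.List.Relation.Binary.Permutation.Propositional.Properties as ↭
open import Data.Nat.ListAction.Properties using (sum-↭)
open import Data.List.Relation.Unary.Unique.Propositional as Unique using (Unique)
import Data.List.Relation.Unary.Unique.Propositional.Properties as Uniqueₚ
open import Data.List.Relation.Unary.AllPairs using ([]; _∷_)
open import Data.List.Properties using (map-tabulate; length-map)
import Data.Vec.Functional as Vector
open import Function using (_∘_; id)
open import Relation.Binary.PropositionalEquality
open import Relation.Binary using (tri<; tri≈; tri>)
open import Relation.Nullary using (does; yes; no; ¬?; _×-dec_; contradiction)

open +-*-Solver using (solve; _:+_; _:=_; con)

open import Algebra.Properties.CommutativeMonoid.Sum +-0-commutativeMonoid
  using (sum-syntax; sum-remove; sum-cong-≗; sum-replicate-zero; ∑-distrib-+)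
open import Algebra.Properties.CommutativeMonoid.Sum ⊔-0-commutativeMonoid
  using () renaming (sum to maximum; sum-remove to maximum-remove; sum-cong-≗ to maximum-cong)

suc-C2 : ∀ d → suc d C 2 ≡ d + d C 2
suc-C2 d = trans (sym (nCk+nC[k+1]≡[n+1]C[k+1] d 1)) (cong (_+ d C 2) (nC1≡n d))

C2≡0 : ∀ {d} → d ≤ 1 → d C 2 ≡ 0
C2≡0 z≤n = refl
C2≡0 (s≤s z≤n) = refl

double-C2 : ∀ d → 2 * (suc d C 2) ≡ suc d * d
double-C2 zero = refl
double-C2 (suc d) = begin
  2 * (suc (suc d) C 2)       ≡⟨ cong (2 *_) (suc-C2 (suc d)) ⟩
  2 * (suc d + suc d C 2)     ≡⟨ *-distribˡ-+ 2 (suc d) _ ⟩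
  2 * suc d + 2 * (suc d C 2) ≡⟨ cong (2 * suc d +_) (double-C2 d) ⟩
  2 * suc d + suc d * d       ≡⟨ cong (_+ suc d * d) (*-comm 2 (suc d)) ⟩
  suc d * 2 + suc d * d       ≡⟨ *-distribˡ-+ (suc d) 2 d ⟨
  suc d * suc (suc d)         ≡⟨ *-comm (suc d) _ ⟩
  suc (suc d) * suc d         ∎
  where open ≡-Reasoning

∑-mono-≤ : ∀ {n} {f g : Fin n → ℕ} → (∀ u → f u ≤ g u) → ∑[ u < n ] f u ≤ ∑[ u < n ] g u
∑-mono-≤ {zero}  f≤g = z≤n
∑-mono-≤ {suc n} f≤g = +-mono-≤ (f≤g zero) (∑-mono-≤ (f≤g ∘ suc))

∑-const : ∀ n c → ∑[ u < n ] c ≡ n * c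
∑-const zero    c = refl
∑-const (suc n) c = cong (c +_) (∑-const n c)

≤-maximum : ∀ {n} (f : Fin n → ℕ) u → f u ≤ maximum f
≤-maximum f zero    = m≤m⊔n _ _
≤-maximum f (suc u) = ≤-trans (≤-maximum (f ∘ suc) u) (m≤n⊔m (f zero) _)

maximum-≤ : ∀ {n} {f : Fin n → ℕ} {d} → (∀ u → f u ≤ d) → maximum f ≤ d
maximum-≤ {zero}  f≤d = z≤n
maximum-≤ {suc n} f≤d = ⊔-lub (f≤d zero) (maximum-≤ (f≤d ∘ suc))

maximum-attained : ∀ {n} (f : Fin n → ℕ) → 1 ≤ maximum f → ∃ λ u → f u ≡ maximum f
maximum-attained {suc n} f 1≤max with ⊔-sel (f zero) (maximum (f ∘ suc))
... | inj₁ max≡f0 = zero , sym max≡f0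
... | inj₂ max≡rest with maximum-attained (f ∘ suc) (subst (1 ≤_) max≡rest 1≤max)
...   | u , fu≡rest = suc u , trans fu≡rest (sym max≡rest)

maximum-≡ : ∀ {n} {f : Fin n → ℕ} {d} u → (∀ w → f w ≤ d) → f u ≡ d → maximum f ≡ d
maximum-≡ {f = f} u f≤d fu≡d = ≤-antisym (maximum-≤ f≤d) (subst (_≤ maximum f) fu≡d (≤-maximum f u))

Edge : ℕ → Set
Edge n = Fin n × Fin n

Ordered : ∀ {n} → Edge n → Set
Ordered e = proj₁ e <ᶠ proj₂ e

incidence : ∀ {n} → Fin n → Edge n → ℕ
incidence u e = incident u (e ∷ [])

incident-∷ : ∀ {n} (u : Fin n) e es → incident u (e ∷ es) ≡ incidence u e + incident u es
incident-∷ u (a , b) es with u Fin.≟ a | u Fin.≟ b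
... | yes _ | _     = refl
... | no _  | yes _ = refl
... | no _  | no _  = refl

data Incidence {n} (u a b : Fin n) : ℕ → Set where
  endpoint : u ≡ a ⊎ u ≡ b → Incidence u a b 1
  away     : u ≢ a → u ≢ b → Incidence u a b 0

incidence-view : ∀ {n} (u a b : Fin n) → Incidence u a b (incidence u (a , b))
incidence-view u a b with u Fin.≟ a | u Fin.≟ b
... | yes u≡a | _       = endpoint (inj₁ u≡a)
... | no _    | yes u≡b = endpoint (inj₂ u≡b)
... | no u≢a  | no u≢b  = away u≢a u≢b

incidence-01 : ∀ {n} (u : Fin n) e → incidence u e ≡ 0 ⊎ incidence u e ≡ 1
incidence-01 u (a , b) with incidence u (a , b) | incidence-view u a b
... | _ | away _ _   = inj₁ refl
... | _ | endpoint _ = inj₂ refl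

incidence≤1 : ∀ {n} (u : Fin n) e → incidence u e ≤ 1
incidence≤1 u (a , b) with incidence u (a , b) | incidence-view u a b
... | _ | endpoint _ = ≤-refl
... | _ | away _ _   = z≤n

kronecker : ∀ {n} → Fin n → Fin n → ℕ
kronecker u a = if does (u Fin.≟ a) then 1 else 0

incidence-kronecker : ∀ {n} {a b : Fin n} u → a ≢ b → incidence u (a , b) ≡ kronecker u a + kronecker u b
incidence-kronecker {a = a} {b} u a≢b with u Fin.≟ a | u Fin.≟ b
... | yes refl | yes refl = contradiction refl a≢b
... | yes _    | no _     = refl
... | no _     | yes _    = refl
... | no _     | no _     = refl

incidence-swap : ∀ {n} (u a b : Fin n) → incidence u (a , b) ≡ incidence u (b , a)
incidence-swap u a b with a Fin.≟ b
... | yes refl = refl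
... | no a≢b   = trans (incidence-kronecker u a≢b)
                       (trans (+-comm (kronecker u a) _) (sym (incidence-kronecker u (a≢b ∘ sym))))

incidence-source : ∀ {n} (a b : Fin n) → incidence a (a , b) ≡ 1
incidence-source a b with incidence a (a , b) | incidence-view a a b
... | _ | endpoint _ = refl
... | _ | away a≢a _ = contradiction refl a≢a

incidence-target : ∀ {n} (a b : Fin n) → incidence b (a , b) ≡ 1
incidence-target a b = trans (incidence-swap b a b) (incidence-source b a)

orient : ∀ {n} {x y : Fin n} → x ≢ y → ∃ λ e → Ordered e × (∀ u → incidence u e ≡ incidence u (x , y))
orient {x = x} {y} x≢y with Fin.<-cmp x y
... | tri< x<y _ _ = (x , y) , x<y , λ _ → refl
... | tri≈ _ x≡y _ = contradiction x≡y x≢y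
... | tri> _ _ y<x = (y , x) , y<x , λ u → incidence-swap u y x

other-endpoint : ∀ {n} {x a b : Fin n} → incidence x (a , b) ≡ 1 →
                 ∃ λ y → incidence y (a , b) ≡ 1 × (∀ (g : Fin n → ℕ) → g a + g b ≡ g x + g y)
other-endpoint {x = x} {a} {b} x∈ab with incidence x (a , b) | incidence-view x a b
... | _ | endpoint (inj₁ refl) = b , incidence-target a b , λ _ → refl
... | _ | endpoint (inj₂ refl) = a , incidence-source a b , λ g → +-comm (g a) (g b)

∑-kronecker : ∀ {n} (a : Fin n) (g : Fin n → ℕ) → ∑[ u < n ] (kronecker u a * g u) ≡ g a
∑-kronecker {suc n} a g = begin
  ∑[ u < suc n ] (kronecker u a * g u)
    ≡⟨ sum-remove {i = a} (λ u → kronecker u a * g u) ⟩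
  kronecker a a * g a + ∑[ w < n ] (kronecker (punchIn a w) a * g (punchIn a w))
    ≡⟨ cong₂ _+_ (cong (_* g a) (kronecker-refl a))
                 (sum-cong-≗ (λ w → cong (_* g (punchIn a w)) (kronecker-≢ (Fin.punchInᵢ≢i a w)))) ⟩
  1 * g a + ∑[ w < n ] 0
    ≡⟨ cong₂ _+_ (*-identityˡ (g a)) (sum-replicate-zero n) ⟩
  g a + 0
    ≡⟨ +-identityʳ (g a) ⟩
  g a ∎
  where
  open ≡-Reasoning
  kronecker-refl : ∀ a → kronecker a a ≡ 1
  kronecker-refl a with a Fin.≟ a
  ... | yes _   = refl
  ... | no a≢a = contradiction refl a≢a
  kronecker-≢ : ∀ {u a} → u ≢ a → kronecker u a ≡ 0
  kronecker-≢ {u} {a} u≢a with u Fin.≟ a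
  ... | yes u≡a = contradiction u≡a u≢a
  ... | no _    = refl

∑-incidence : ∀ {n} {a b : Fin n} (g : Fin n → ℕ) → a ≢ b →
              ∑[ u < n ] (incidence u (a , b) * g u) ≡ g a + g b
∑-incidence {n} {a} {b} g a≢b = begin
  ∑[ u < n ] (incidence u (a , b) * g u)
    ≡⟨ sum-cong-≗ (λ u → trans (cong (_* g u) (incidence-kronecker u a≢b))
                               (*-distribʳ-+ (g u) (kronecker u a) _)) ⟩
  ∑[ u < n ] (kronecker u a * g u + kronecker u b * g u)
    ≡⟨ ∑-distrib-+ (λ u → kronecker u a * g u) (λ u → kronecker u b * g u) ⟩
  ∑[ u < n ] (kronecker u a * g u) + ∑[ u < n ] (kronecker u b * g u)
    ≡⟨ cong₂ _+_ (∑-kronecker a g) (∑-kronecker b g) ⟩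
  g a + g b ∎
  where open ≡-Reasoning

foldr-map-allFin : ∀ (_∙_ : ℕ → ℕ → ℕ) ε {n} (f : Fin n → ℕ) →
                   foldr _∙_ ε (map f (allFin n)) ≡ Vector.foldr _∙_ ε f
foldr-map-allFin _∙_ ε f = trans (cong (foldr _∙_ ε) (map-tabulate id f)) (foldr-tabulate f)
  where
  foldr-tabulate : ∀ {n} (g : Fin n → ℕ) → foldr _∙_ ε (tabulate g) ≡ Vector.foldr _∙_ ε g
  foldr-tabulate {zero}  g = refl
  foldr-tabulate {suc n} g = cong (g zero ∙_) (foldr-tabulate (g ∘ suc))

lineCount : ∀ {n} → List (Edge n) → ℕ
lineCount {n} es = ∑[ u < n ] (incident u es C 2)

lineEdges≡lineCount : ∀ G → lineEdges G ≡ lineCount (edges G)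
lineEdges≡lineCount G = foldr-map-allFin _+_ 0 (λ v → deg G v C 2)

maxDeg≡maximum : ∀ G → maxDeg G ≡ maximum (deg G)
maxDeg≡maximum G = foldr-map-allFin _⊔_ 0 (deg G)

lineCount-cong : ∀ {n} {es es′ : List (Edge n)} → (∀ u → incident u es ≡ incident u es′) →
                 lineCount es ≡ lineCount es′
lineCount-cong es≗es′ = sum-cong-≗ (λ u → cong (_C 2) (es≗es′ u))

lineCount-∷ : ∀ {n} {a b : Fin n} es → a ≢ b →
              lineCount ((a , b) ∷ es) ≡ lineCount es + (incident a es + incident b es)
lineCount-∷ {n} {a} {b} es a≢b = begin
  ∑[ u < n ] (incident u ((a , b) ∷ es) C 2)
    ≡⟨ sum-cong-≗ (λ u → trans (cong (_C 2) (incident-∷ u (a , b) es)) (C2-+ (incidence≤1 u (a , b)))) ⟩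
  ∑[ u < n ] (incidence u (a , b) * incident u es + incident u es C 2)
    ≡⟨ ∑-distrib-+ (λ u → incidence u (a , b) * incident u es) (λ u → incident u es C 2) ⟩
  ∑[ u < n ] (incidence u (a , b) * incident u es) + lineCount es
    ≡⟨ cong (_+ lineCount es) (∑-incidence (λ u → incident u es) a≢b) ⟩
  incident a es + incident b es + lineCount es
    ≡⟨ +-comm _ (lineCount es) ⟩
  lineCount es + (incident a es + incident b es) ∎
  where
  open ≡-Reasoning
  C2-+ : ∀ {i d} → i ≤ 1 → (i + d) C 2 ≡ i * d + d C 2
  C2-+ {d = d} z≤n       = refl
  C2-+ {d = d} (s≤s z≤n) = trans (suc-C2 d) (cong (_+ d C 2) (sym (*-identityˡ d)))

handshake : ∀ {n} {es : List (Edge n)} → All Ordered es → ∑[ u < n ] incident u es ≡ 2 * length es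
handshake {n} [] = sum-replicate-zero n
handshake {n} {(a , b) ∷ es} (a<b ∷ ordered) = begin
  ∑[ u < n ] incident u ((a , b) ∷ es)
    ≡⟨ sum-cong-≗ (λ u → trans (incident-∷ u (a , b) es) (cong (_+ incident u es) (sym (*-identityʳ _)))) ⟩
  ∑[ u < n ] (incidence u (a , b) * 1 + incident u es)
    ≡⟨ ∑-distrib-+ (λ u → incidence u (a , b) * 1) (λ u → incident u es) ⟩
  ∑[ u < n ] (incidence u (a , b) * 1) + ∑[ u < n ] incident u es
    ≡⟨ cong₂ _+_ (∑-incidence (λ _ → 1) (Fin.<⇒≢ a<b)) (handshake ordered) ⟩
  2 + 2 * length es
    ≡⟨ *-suc 2 (length es) ⟨
  2 * length ((a , b) ∷ es) ∎
  where open ≡-Reasoning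

lineCount≡0 : ∀ {n} {es : List (Edge n)} → (∀ u → incident u es ≤ 1) → lineCount es ≡ 0
lineCount≡0 {n} d≤1 = trans (sum-cong-≗ (λ u → C2≡0 (d≤1 u))) (sum-replicate-zero n)

edgesBetween : ∀ {n} → Fin n → Fin n → List (Edge n) → ℕ
edgesBetween x y []       = 0
edgesBetween x y (e ∷ es) = incidence x e * incidence y e + edgesBetween x y es

edgesBetween-self : ∀ {n} (v : Fin n) es → edgesBetween v v es ≡ incident v es
edgesBetween-self v []             = refl
edgesBetween-self v ((a , b) ∷ es) =
  trans (cong₂ _+_ incidence-idem (edgesBetween-self v es)) (sym (incident-∷ v (a , b) es))
  where
  incidence-idem : incidence v (a , b) * incidence v (a , b) ≡ incidence v (a , b)
  incidence-idem with incidence v (a , b) | incidence-view v a b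
  ... | _ | endpoint _ = refl
  ... | _ | away _ _   = refl

∑-edgesBetween : ∀ {n} (v : Fin n) {es} → All Ordered es → ∑[ u < n ] edgesBetween u v es ≡ 2 * incident v es
∑-edgesBetween {n} v [] = sum-replicate-zero n
∑-edgesBetween {n} v {(a , b) ∷ es} (a<b ∷ ordered) = begin
  ∑[ u < n ] (incidence u (a , b) * incidence v (a , b) + edgesBetween u v es)
    ≡⟨ ∑-distrib-+ (λ u → incidence u (a , b) * incidence v (a , b)) (λ u → edgesBetween u v es) ⟩
  ∑[ u < n ] (incidence u (a , b) * incidence v (a , b)) + ∑[ u < n ] edgesBetween u v es
    ≡⟨ cong₂ _+_ (∑-incidence (λ _ → incidence v (a , b)) (Fin.<⇒≢ a<b)) (∑-edgesBetween v ordered) ⟩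
  incidence v (a , b) + incidence v (a , b) + 2 * incident v es
    ≡⟨ cong (λ k → incidence v (a , b) + k + 2 * incident v es) (+-identityʳ _) ⟨
  2 * incidence v (a , b) + 2 * incident v es
    ≡⟨ *-distribˡ-+ 2 (incidence v (a , b)) _ ⟨
  2 * (incidence v (a , b) + incident v es)
    ≡⟨ cong (2 *_) (incident-∷ v (a , b) es) ⟨
  2 * incident v ((a , b) ∷ es) ∎
  where open ≡-Reasoning

∈⇒≤edgesBetween : ∀ {n} {x y : Fin n} {e es} → e ∈ es →
                  incidence x e * incidence y e ≤ edgesBetween x y es
∈⇒≤edgesBetween (here refl)  = m≤m+n _ _
∈⇒≤edgesBetween (there e∈es) = ≤-trans (∈⇒≤edgesBetween e∈es) (m≤n+m _ _)

both-endpoints : ∀ {n} {x y a b : Fin n} → x ≢ y → incidence x (a , b) ≡ 1 → incidence y (a , b) ≡ 1 →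
                 (x ≡ a × y ≡ b) ⊎ (x ≡ b × y ≡ a)
both-endpoints {x = x} {y} {a} {b} x≢y x∈e y∈e
  with incidence x (a , b) | incidence-view x a b | incidence y (a , b) | incidence-view y a b
... | _ | endpoint (inj₁ x≡a) | _ | endpoint (inj₁ y≡a) = contradiction (trans x≡a (sym y≡a)) x≢y
... | _ | endpoint (inj₁ x≡a) | _ | endpoint (inj₂ y≡b) = inj₁ (x≡a , y≡b)
... | _ | endpoint (inj₂ x≡b) | _ | endpoint (inj₁ y≡a) = inj₂ (x≡b , y≡a)
... | _ | endpoint (inj₂ x≡b) | _ | endpoint (inj₂ y≡b) = contradiction (trans x≡b (sym y≡b)) x≢y

ordered-edge-unique : ∀ {n} {x y : Fin n} {e e′} → x ≢ y → Ordered e → Ordered e′ →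
                      incidence x e ≡ 1 → incidence y e ≡ 1 →
                      incidence x e′ ≡ 1 → incidence y e′ ≡ 1 → e ≡ e′
ordered-edge-unique x≢y a<b a′<b′ x∈e y∈e x∈e′ y∈e′
  with both-endpoints x≢y x∈e y∈e | both-endpoints x≢y x∈e′ y∈e′
... | inj₁ (refl , refl) | inj₁ (refl , refl) = refl
... | inj₂ (refl , refl) | inj₂ (refl , refl) = refl
... | inj₁ (refl , refl) | inj₂ (refl , refl) = contradiction a<b (Fin.<-asym a′<b′)
... | inj₂ (refl , refl) | inj₁ (refl , refl) = contradiction a<b (Fin.<-asym a′<b′)

edgesBetween≡0 : ∀ {n} {x y : Fin n} {es} → All (λ e → incidence x e * incidence y e ≡ 0) es →
                 edgesBetween x y es ≡ 0
edgesBetween≡0 []              = refl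
edgesBetween≡0 (none ∷ nones) = cong₂ _+_ none (edgesBetween≡0 nones)

joins? : ∀ {n} (x y : Fin n) e → incidence x e * incidence y e ≡ 0 ⊎ (incidence x e ≡ 1 × incidence y e ≡ 1)
joins? x y (a , b) with incidence x (a , b) | incidence-view x a b | incidence y (a , b) | incidence-view y a b
... | _ | away _ _   | _ | _          = inj₁ refl
... | _ | endpoint _ | _ | away _ _   = inj₁ refl
... | _ | endpoint _ | _ | endpoint _ = inj₂ (refl , refl)

edgesBetween≤1 : ∀ {n} {x y : Fin n} {es} → x ≢ y → All Ordered es → Unique es → edgesBetween x y es ≤ 1
edgesBetween≤1 {es = []} _ _ _ = z≤n
edgesBetween≤1 {x = x} {y} {e ∷ es} x≢y (o ∷ os) (e∉es ∷ u) with joins? x y e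
... | inj₁ none          = subst (_≤ 1) (cong (_+ edgesBetween x y es) (sym none)) (edgesBetween≤1 x≢y os u)
... | inj₂ (x∈e , y∈e) =
  ≤-reflexive (cong₂ _+_ (cong₂ _*_ x∈e y∈e) (edgesBetween≡0 (only-e es os e∉es)))
  where
  only-e : ∀ es → All Ordered es → All (e ≢_) es →
           All (λ e′ → incidence x e′ * incidence y e′ ≡ 0) es
  only-e []        []        []          = []
  only-e (e′ ∷ es) (o′ ∷ os) (e≢e′ ∷ ns) with joins? x y e′
  ... | inj₁ none            = none ∷ only-e es os ns
  ... | inj₂ (x∈e′ , y∈e′) =
    contradiction (ordered-edge-unique x≢y o o′ x∈e y∈e x∈e′ y∈e′) e≢e′

non-adjacent-edge : ∀ {m} {x v : Fin m} {e es} → edgesBetween x v es ≡ 0 → e ∈ es →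
                    incidence x e ≡ 1 → incidence v e ≡ 0
non-adjacent-edge {x = x} {v} {e} {es} x≁v e∈es x∈e = n≤0⇒n≡0 (begin
  incidence v e                   ≡⟨ +-identityʳ _ ⟨
  1 * incidence v e               ≡⟨ cong (_* incidence v e) x∈e ⟨
  incidence x e * incidence v e   ≤⟨ ∈⇒≤edgesBetween e∈es ⟩
  edgesBetween x v es             ≡⟨ x≁v ⟩
  0                               ∎)
  where open ≤-Reasoning

mapEdge : ∀ {m n} → (Fin m → Fin n) → Edge m → Edge n
mapEdge φ (a , b) = φ a , φ b

module _ {m n} {φ : Fin m → Fin n} where

  incidence-map : (∀ {i j} → φ i ≡ φ j → i ≡ j) → ∀ u e →
                  incidence (φ u) (mapEdge φ e) ≡ incidence u e
  incidence-map φ-inj u (a , b)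
    with incidence (φ u) (φ a , φ b) | incidence-view (φ u) (φ a) (φ b) | incidence u (a , b) | incidence-view u a b
  ... | _ | endpoint _                | _ | endpoint _             = refl
  ... | _ | away _ _                  | _ | away _ _               = refl
  ... | _ | endpoint (inj₁ φu≡φa)    | _ | away u≢a _            = contradiction (φ-inj φu≡φa) u≢a
  ... | _ | endpoint (inj₂ φu≡φb)    | _ | away _ u≢b            = contradiction (φ-inj φu≡φb) u≢b
  ... | _ | away φu≢φa _             | _ | endpoint (inj₁ u≡a)   = contradiction (cong φ u≡a) φu≢φa
  ... | _ | away _ φu≢φb             | _ | endpoint (inj₂ u≡b)   = contradiction (cong φ u≡b) φu≢φb

  incident-map : (∀ {i j} → φ i ≡ φ j → i ≡ j) → ∀ u es →
                 incident (φ u) (map (mapEdge φ) es) ≡ incident u es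
  incident-map φ-inj u []       = refl
  incident-map φ-inj u (e ∷ es) = begin
    incident (φ u) (mapEdge φ e ∷ map (mapEdge φ) es)
      ≡⟨ incident-∷ (φ u) (mapEdge φ e) _ ⟩
    incidence (φ u) (mapEdge φ e) + incident (φ u) (map (mapEdge φ) es)
      ≡⟨ cong₂ _+_ (incidence-map φ-inj u e) (incident-map φ-inj u es) ⟩
    incidence u e + incident u es
      ≡⟨ incident-∷ u e es ⟨
    incident u (e ∷ es) ∎
    where open ≡-Reasoning

  incident-outside-image : ∀ {u} → (∀ w → φ w ≢ u) → ∀ es → incident u (map (mapEdge φ) es) ≡ 0
  incident-outside-image u∉φ []             = refl
  incident-outside-image {u} u∉φ ((a , b) ∷ es) =
    trans (incident-∷ u (φ a , φ b) _) (cong₂ _+_ incidence≡0 (incident-outside-image u∉φ es))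
    where
    incidence≡0 : incidence u (φ a , φ b) ≡ 0
    incidence≡0 with incidence u (φ a , φ b) | incidence-view u (φ a) (φ b)
    ... | _ | endpoint (inj₁ u≡φa) = contradiction (sym u≡φa) (u∉φ a)
    ... | _ | endpoint (inj₂ u≡φb) = contradiction (sym u≡φb) (u∉φ b)
    ... | _ | away _ _             = refl

  map-unique : (∀ {i j} → φ i ≡ φ j → i ≡ j) → ∀ {es} → Unique es → Unique (map (mapEdge φ) es)
  map-unique φ-inj = Uniqueₚ.map⁺ mapEdge-injective
    where
    mapEdge-injective : ∀ {e e′} → mapEdge φ e ≡ mapEdge φ e′ → e ≡ e′
    mapEdge-injective {a , b} {a′ , b′} eq = cong₂ _,_ (φ-inj (cong proj₁ eq)) (φ-inj (cong proj₂ eq))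

shift : ∀ {n} → List (Edge n) → List (Edge (suc n))
shift = map (mapEdge suc)

shift-ordered : ∀ {n} {es : List (Edge n)} → All Ordered es → All Ordered (shift es)
shift-ordered []            = []
shift-ordered (a<b ∷ ordered) = s≤s a<b ∷ shift-ordered ordered

shift-unique : ∀ {n} {es : List (Edge n)} → Unique es → Unique (shift es)
shift-unique = map-unique Fin.suc-injective

incident-shift : ∀ {n} (u : Fin n) es → incident (suc u) (shift es) ≡ incident u es
incident-shift = incident-map Fin.suc-injective

incident-shift-zero : ∀ {n} (es : List (Edge n)) → incident zero (shift es) ≡ 0
incident-shift-zero = incident-outside-image (λ _ ())

lineCount-shift : ∀ {n} (es : List (Edge n)) → lineCount (shift es) ≡ lineCount es
lineCount-shift es =
  cong₂ _+_ (cong (_C 2) (incident-shift-zero es)) (sum-cong-≗ (λ u → cong (_C 2) (incident-shift u es)))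

shift-avoids : ∀ {n} (x : Fin (suc n)) (es : List (Edge n)) → All ((zero , x) ≢_) (shift es)
shift-avoids x []       = []
shift-avoids x (e ∷ es) = (λ ()) ∷ shift-avoids x es

graph : ∀ {m} (es : List (Edge m)) → All Ordered es → Unique es → Graph
graph {m} es ordered unique = record { n = m ; edges = es ; ordered = ordered ; unique = unique }

avoids : ∀ {n} (y : Fin n) es → incident y es ≡ 0 → All (λ e → incidence y e ≡ 0) es
avoids y []       _          = []
avoids y (e ∷ es) isolated = m+n≡0⇒m≡0 _ isolated′ ∷ avoids y es (m+n≡0⇒n≡0 (incidence y e) isolated′)
  where
  isolated′ : incidence y e + incident y es ≡ 0
  isolated′ = trans (sym (incident-∷ y e es)) isolated

unpunch : ∀ {m} (y : Fin (suc m)) es → All (λ e → incidence y e ≡ 0) es →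
          ∃ λ es′ → es ≡ map (mapEdge (punchIn y)) es′
unpunch y []             []              = [] , refl
unpunch y ((a , b) ∷ es) (y∉ab ∷ y∉es) with incidence y (a , b) | incidence-view y a b
... | _ | away y≢a y≢b with unpunch y es y∉es
...   | es′ , refl = (punchOut y≢a , punchOut y≢b) ∷ es′ ,
                     cong (_∷ _) (sym (cong₂ _,_ (Fin.punchIn-punchOut y≢a) (Fin.punchIn-punchOut y≢b)))

unpunch-ordered : ∀ {m} (y : Fin (suc m)) es → All Ordered (map (mapEdge (punchIn y)) es) → All Ordered es
unpunch-ordered y []             []              = []
unpunch-ordered y ((a , b) ∷ es) (ya<yb ∷ ordered) =
  Fin.≤∧≢⇒< (Fin.punchIn-cancel-≤ y a b (<⇒≤ ya<yb))
            (λ a≡b → Fin.<⇒≢ ya<yb (cong (punchIn y) a≡b))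
  ∷ unpunch-ordered y es ordered

record Realisation {m} (es : List (Edge m)) : Set where
  field
    realiser   : Graph
    numEdges≡  : numEdges realiser ≡ length es
    maxDeg≡    : maxDeg realiser ≡ maximum (λ u → incident u es)
    lineEdges≡ : lineEdges realiser ≡ lineCount es
    noIsolated : minDegPos realiser

realisation : ∀ {m} (es : List (Edge m)) → All Ordered es → Unique es → Realisation es
realisation {zero} es ordered unique =
  record { realiser = G ; numEdges≡ = refl ; maxDeg≡ = maxDeg≡maximum G
         ; lineEdges≡ = lineEdges≡lineCount G ; noIsolated = λ () }
  where
  G : Graph
  G = graph es ordered unique
realisation {suc m} es ordered unique with Fin.any? (λ y → incident y es ≟ 0)
... | no ¬isolated =
  record { realiser = G ; numEdges≡ = refl ; maxDeg≡ = maxDeg≡maximum G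
         ; lineEdges≡ = lineEdges≡lineCount G
         ; noIsolated = λ v → n≢0⇒n>0 (λ dv≡0 → ¬isolated (v , dv≡0)) }
  where
  G : Graph
  G = graph es ordered unique
... | yes (y , isolated) with unpunch y es (avoids y es isolated)
...   | es′ , refl = record
  { realiser   = R.realiser
  ; numEdges≡  = trans R.numEdges≡ (sym (length-map _ es′))
  ; maxDeg≡    = trans R.maxDeg≡ (sym (trans (maximum-remove {i = y} (λ u → incident u es))
                   (cong₂ _⊔_ isolated (maximum-cong (λ w → incident-map φ-inj w es′)))))
  ; lineEdges≡ = trans R.lineEdges≡ (sym (trans (sum-remove {i = y} (λ u → incident u es C 2))
                   (cong₂ _+_ (cong (_C 2) isolated)
                              (sum-cong-≗ (λ w → cong (_C 2) (incident-map φ-inj w es′))))))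
  ; noIsolated = R.noIsolated
  }
  where
  φ-inj : ∀ {i j} → punchIn y i ≡ punchIn y j → i ≡ j
  φ-inj = Fin.punchIn-injective y _ _
  module R = Realisation (realisation es′ (unpunch-ordered y es′ ordered) (Uniqueₚ.map⁻ unique))

incident≡sum : ∀ {n} (u : Fin n) es → incident u es ≡ sum (map (incidence u) es)
incident≡sum u []       = refl
incident≡sum u (e ∷ es) = trans (incident-∷ u e es) (cong (incidence u e +_) (incident≡sum u es))

incident-↭ : ∀ {n} (u : Fin n) {es es′} → es ↭ es′ → incident u es ≡ incident u es′
incident-↭ u {es} {es′} σ = begin
  incident u es                 ≡⟨ incident≡sum u es ⟩
  sum (map (incidence u) es)    ≡⟨ sum-↭ (↭.map⁺ (incidence u) σ) ⟩
  sum (map (incidence u) es′)   ≡⟨ incident≡sum u es′ ⟨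
  incident u es′                ∎
  where open ≡-Reasoning

record EdgeSplit {m} (es : List (Edge m)) (e : Edge m) : Set where
  field
    rest      : List (Edge m)
    ordered-e∷rest : All Ordered (e ∷ rest)
    unique-e∷rest  : Unique (e ∷ rest)
    length≡   : length es ≡ suc (length rest)
    incident≡ : ∀ u → incident u es ≡ incidence u e + incident u rest
    rest⊆     : ∀ {f} → f ∈ rest → f ∈ es

module _ {m : ℕ} where
  open import Data.List.Relation.Binary.Permutation.Setoid.Properties (setoid (Edge m)) using (Unique-resp-↭)

  split : ∀ {e} {es : List (Edge m)} → e ∈ es → All Ordered es → Unique es → EdgeSplit es e
  split {e} e∈es ordered unique with ∈-∃++ e∈es
  ... | ys , zs , refl = record
    { rest      = ys ++ zs
    ; ordered-e∷rest = ↭.All-resp-↭ σ ordered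
    ; unique-e∷rest  = Unique-resp-↭ (↭⇒↭ₛ σ) unique
    ; length≡   = ↭.↭-length σ
    ; incident≡ = λ u → trans (incident-↭ u σ) (incident-∷ u e (ys ++ zs))
    ; rest⊆     = λ f∈rest → ↭.∈-resp-↭ (↭-sym σ) (there f∈rest)
    }
    where
    σ : ys ++ e ∷ zs ↭ e ∷ ys ++ zs
    σ = ↭.shift e ys zs

lineCount-split : ∀ {m} {es : List (Edge m)} {a b} (s : EdgeSplit es (a , b)) →
                  let open EdgeSplit s in lineCount es ≡ lineCount rest + (incident a rest + incident b rest)
lineCount-split {es = es} {a} {b} s =
  trans (lineCount-cong {es = es} {(a , b) ∷ rest} incident≡′)
        (lineCount-∷ rest (Fin.<⇒≢ (All.head ordered-e∷rest)))
  where
  open EdgeSplit s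
  incident≡′ : ∀ u → incident u es ≡ incident u ((a , b) ∷ rest)
  incident≡′ u = trans (incident≡ u) (sym (incident-∷ u (a , b) rest))

incident-rest≤ : ∀ {m} {es : List (Edge m)} {e} (s : EdgeSplit es e) u →
                 incident u (EdgeSplit.rest s) ≤ incident u es
incident-rest≤ s u = subst (_ ≤_) (sym (EdgeSplit.incident≡ s u)) (m≤n+m _ _)

incident-rest≡ : ∀ {m} {es : List (Edge m)} {e} (s : EdgeSplit es e) {u} → incidence u e ≡ 0 →
                 incident u (EdgeSplit.rest s) ≡ incident u es
incident-rest≡ s {u} u∉e = sym (trans (EdgeSplit.incident≡ s u) (cong (_+ _) u∉e))

∃-edge : ∀ {m} (es : List (Edge m)) → 1 ≤ length es → ∃ λ e → e ∈ es
∃-edge (e ∷ _) _ = e , here refl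

∃-incident-edge : ∀ {m} {x : Fin m} es → 1 ≤ incident x es → ∃ λ e → e ∈ es × incidence x e ≡ 1
∃-incident-edge {x = x} (e ∷ es) 1≤dx with incidence-01 x e
... | inj₂ x∈e = e , here refl , x∈e
... | inj₁ x∉e with ∃-incident-edge es (subst (1 ≤_) (trans (incident-∷ x e es) (cong (_+ _) x∉e)) 1≤dx)
...   | f , f∈es , x∈f = f , there f∈es , x∈f

∃-avoiding-edge : ∀ {m} {v : Fin m} es → incident v es < length es → ∃ λ e → e ∈ es × incidence v e ≡ 0
∃-avoiding-edge {v = v} (e ∷ es) dv<length with incidence-01 v e
... | inj₁ v∉e = e , here refl , v∉e
... | inj₂ v∈e
  with ∃-avoiding-edge es
         (s≤s⁻¹ (subst (_< suc (length es)) (trans (incident-∷ v e es) (cong (_+ _) v∈e)) dv<length))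
...   | f , f∈es , v∉f = f , there f∈es , v∉f

admissible : ∀ {m N Δ L b} {es : List (Edge m)} → All Ordered es → Unique es →
             length es ≡ N → maximum (λ u → incident u es) ≡ Δ → L ≤ lineCount es + b →
             ∃ λ G → Admissible N Δ G × L ≤ lineEdges G + b
admissible {b = b} {es} ordered unique length≡N max≡Δ L≤ =
  R.realiser , (trans R.numEdges≡ length≡N , trans R.maxDeg≡ max≡Δ , R.noIsolated) ,
  subst (λ k → _ ≤ k + b) (sym R.lineEdges≡) L≤
  where module R = Realisation (realisation es ordered unique)

IsF-compare : ∀ {N Δ N′ Δ′ m m′} a b →
              (∀ G → Admissible N Δ G →
                 ∃ λ G′ → Admissible N′ Δ′ G′ × lineEdges G + a ≤ lineEdges G′ + b) →
              IsF N Δ m → IsF N′ Δ′ m′ → m + a ≤ m′ + b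
IsF-compare a b improve ((G , adm , refl) , _) (_ , bound) with improve G adm
... | G′ , adm′ , improvement = ≤-trans improvement (+-monoˡ-≤ b (bound G′ adm′))

deg≤maxDeg : ∀ G v → deg G v ≤ maxDeg G
deg≤maxDeg G v = subst (deg G v ≤_) (sym (maxDeg≡maximum G)) (≤-maximum (deg G) v)

maxDeg-attained : ∀ G → 1 ≤ maxDeg G → ∃ λ v → deg G v ≡ maxDeg G
maxDeg-attained G 1≤Δ with maximum-attained (deg G) (subst (1 ≤_) (maxDeg≡maximum G) 1≤Δ)
... | v , dv≡max = v , trans dv≡max (sym (maxDeg≡maximum G))

matching : ℕ → Graph
matching zero    = graph {0} [] [] []
matching (suc N) = graph ((zero , suc zero) ∷ shift (shift (edges M)))
                         (s≤s z≤n ∷ shift-ordered (shift-ordered (ordered M)))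
                         (shift-avoids (suc zero) (shift (edges M)) ∷ shift-unique (shift-unique (unique M)))
  where
  M : Graph
  M = matching N

matching-length : ∀ N → numEdges (matching N) ≡ N
matching-length zero    = refl
matching-length (suc N) = cong suc (begin
  length (shift (shift es)) ≡⟨ length-map (mapEdge suc) (shift es) ⟩
  length (shift es)         ≡⟨ length-map (mapEdge suc) es ⟩
  length es                 ≡⟨ matching-length N ⟩
  N                         ∎)
  where
  open ≡-Reasoning
  es : List (Edge (n (matching N)))
  es = edges (matching N)

matching-deg≤1 : ∀ N u → deg (matching N) u ≤ 1
matching-deg≤1 (suc N) zero          = ≤-reflexive (cong suc (incident-shift-zero (shift (edges (matching N)))))
matching-deg≤1 (suc N) (suc zero)    =
  ≤-reflexive (cong suc (trans (incident-shift zero (shift (edges (matching N))))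
                              (incident-shift-zero (edges (matching N)))))
matching-deg≤1 (suc N) (suc (suc u)) =
  subst (_≤ 1) (sym (trans (incident-shift (suc u) (shift es)) (incident-shift u es))) (matching-deg≤1 N u)
  where
  es : List (Edge (n (matching N)))
  es = edges (matching N)

matching-maximum : ∀ N → maximum (deg (matching (suc N))) ≡ 1
matching-maximum N =
  maximum-≡ zero (matching-deg≤1 (suc N)) (cong suc (incident-shift-zero (shift (edges (matching N)))))

lineEdges≡0 : ∀ {N} G → Admissible N 1 G → lineEdges G ≡ 0
lineEdges≡0 G (_ , Δ≡1 , _) =
  trans (lineEdges≡lineCount G) (lineCount≡0 {es = edges G} (λ u → subst (deg G u ≤_) Δ≡1 (deg≤maxDeg G u)))

f[N,1]≡0 : ∀ N → 1 ≤ N → IsF N 1 0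
f[N,1]≡0 (suc N) _
  with G , adm , _ ← admissible {b = 0} (ordered (matching (suc N))) (unique (matching (suc N)))
                                  (matching-length (suc N)) (matching-maximum N) z≤n
  = (G , adm , lineEdges≡0 G adm) , λ G′ adm′ → ≤-reflexive (lineEdges≡0 G′ adm′)

module Subdivision {m} {es : List (Edge m)} {a b} (s : EdgeSplit es (a , b)) where
  open EdgeSplit s

  a≢b : a ≢ b
  a≢b = Fin.<⇒≢ (All.head ordered-e∷rest)

  subdivided : Graph
  subdivided = graph ((zero , suc a) ∷ (zero , suc b) ∷ shift rest)
                     (s≤s z≤n ∷ s≤s z≤n ∷ shift-ordered (All.tail ordered-e∷rest))
                     (((λ eq → a≢b (Fin.suc-injective (cong proj₂ eq))) ∷ shift-avoids (suc a) rest)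
                       ∷ shift-avoids (suc b) rest ∷ shift-unique (Unique.tail unique-e∷rest))

  numEdges-subdivided : numEdges subdivided ≡ suc (length es)
  numEdges-subdivided = cong suc (trans (cong suc (length-map _ rest)) (sym length≡))

  deg-subdivided-zero : deg subdivided zero ≡ 2
  deg-subdivided-zero = cong (λ k → suc (suc k)) (incident-shift-zero rest)

  deg-subdivided-suc : ∀ u → deg subdivided (suc u) ≡ incident u es
  deg-subdivided-suc u = begin
    deg subdivided (suc u)
      ≡⟨ incident-∷ (suc u) (zero , suc a) _ ⟩
    incidence (suc u) (zero , suc a) + incident (suc u) ((zero , suc b) ∷ shift rest)
      ≡⟨ cong (incidence (suc u) (zero , suc a) +_) (incident-∷ (suc u) (zero , suc b) (shift rest)) ⟩
    incidence (suc u) (zero , suc a) + (incidence (suc u) (zero , suc b) + incident (suc u) (shift rest))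
      ≡⟨ +-assoc (incidence (suc u) (zero , suc a)) _ _ ⟨
    incidence (suc u) (zero , suc a) + incidence (suc u) (zero , suc b) + incident (suc u) (shift rest)
      ≡⟨ cong₂ _+_ new-edges (incident-shift u rest) ⟩
    incidence u (a , b) + incident u rest
      ≡⟨ incident≡ u ⟨
    incident u es ∎
    where
    open ≡-Reasoning
    new-edges : incidence (suc u) (zero , suc a) + incidence (suc u) (zero , suc b) ≡ incidence u (a , b)
    new-edges = trans (cong₂ _+_ (incidence-kronecker {a = zero} {suc a} (suc u) (λ ()))
                                 (incidence-kronecker {a = zero} {suc b} (suc u) (λ ())))
                      (sym (incidence-kronecker u a≢b))

subdivision-improves : ∀ {N Δ} G → 2 ≤ Δ → 1 ≤ N → Admissible N Δ G →
                       ∃ λ G′ → Admissible (suc N) Δ G′ × lineEdges G + 1 ≤ lineEdges G′ + 0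
subdivision-improves G 2≤Δ 1≤N (refl , refl , _)
  with e , e∈G ← ∃-edge (edges G) 1≤N
  with v , dv≡Δ ← maxDeg-attained G (≤-trans (s≤s z≤n) 2≤Δ)
  = admissible (ordered subdivided) (unique subdivided) numEdges-subdivided
               (maximum-≡ (suc v) deg≤Δ (trans (deg-subdivided-suc v) dv≡Δ)) (≤-reflexive gain)
  where
  open Subdivision (split e∈G (ordered G) (unique G))
  deg≤Δ : ∀ u → deg subdivided u ≤ maxDeg G
  deg≤Δ zero    = subst (_≤ maxDeg G) (sym deg-subdivided-zero) 2≤Δ
  deg≤Δ (suc u) = subst (_≤ maxDeg G) (sym (deg-subdivided-suc u)) (deg≤maxDeg G u)
  gain : lineEdges G + 1 ≡ lineCount (edges subdivided) + 0
  gain = begin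
    lineEdges G + 1                   ≡⟨ +-comm (lineEdges G) 1 ⟩
    1 + lineEdges G                   ≡⟨ cong₂ _+_ (cong (_C 2) deg-subdivided-zero) lineCount-subdivided-suc ⟨
    lineCount (edges subdivided)      ≡⟨ +-identityʳ _ ⟨
    lineCount (edges subdivided) + 0  ∎
    where
    open ≡-Reasoning
    lineCount-subdivided-suc : ∑[ u < n G ] (deg subdivided (suc u) C 2) ≡ lineEdges G
    lineCount-subdivided-suc =
      trans (sum-cong-≗ (λ u → cong (_C 2) (deg-subdivided-suc u))) (sym (lineEdges≡lineCount G))

f[N+1,Δ]≥f[N,Δ]+1 : ∀ N Δ m m′ → 2 ≤ Δ → Δ ≤ N → IsF N Δ m → IsF (suc N) Δ m′ → m′ ≥ m + 1
f[N+1,Δ]≥f[N,Δ]+1 N Δ m m′ 2≤Δ Δ≤N isF isF′ = subst (m + 1 ≤_) (+-identityʳ m′)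
  (IsF-compare 1 0 (λ G → subdivision-improves G 2≤Δ (≤-trans (≤-trans (s≤s z≤n) 2≤Δ) Δ≤N))
                   isF isF′)

vertices≤suc-deg : ∀ {m} {es : List (Edge m)} {v} → All Ordered es →
                   (∀ x → x ≢ v → 1 ≤ edgesBetween x v es) → m ≤ suc (incident v es)
vertices≤suc-deg {suc m} {es} {v} ordered adjacent = s≤s (+-cancelˡ-≤ (incident v es) m _ (begin
  incident v es + m
    ≡⟨ cong₂ _+_ (edgesBetween-self v es) (trans (∑-const m 1) (*-identityʳ m)) ⟨
  edgesBetween v v es + ∑[ w < m ] 1
    ≤⟨ +-monoʳ-≤ (edgesBetween v v es) (∑-mono-≤ (λ w → adjacent (punchIn v w) (Fin.punchInᵢ≢i v w))) ⟩
  edgesBetween v v es + ∑[ w < m ] edgesBetween (punchIn v w) v es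
    ≡⟨ sum-remove {i = v} (λ u → edgesBetween u v es) ⟨
  ∑[ u < suc m ] edgesBetween u v es
    ≡⟨ ∑-edgesBetween v ordered ⟩
  2 * incident v es
    ≡⟨ cong (incident v es +_) (+-identityʳ _) ⟩
  incident v es + incident v es ∎))
  where open ≤-Reasoning

length≤C2 : ∀ {m} {es : List (Edge m)} {Δ} → All Ordered es → (∀ u → incident u es ≤ Δ) →
            m ≤ suc Δ → length es ≤ suc Δ C 2
length≤C2 {m} {es} {Δ} ordered d≤Δ m≤1+Δ = *-cancelˡ-≤ 2 (begin
  2 * length es             ≡⟨ handshake ordered ⟨
  ∑[ u < m ] incident u es  ≤⟨ ∑-mono-≤ d≤Δ ⟩
  ∑[ u < m ] Δ              ≡⟨ ∑-const m Δ ⟩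
  m * Δ                     ≤⟨ *-monoˡ-≤ Δ m≤1+Δ ⟩
  suc Δ * Δ                 ≡⟨ double-C2 Δ ⟨
  2 * (suc Δ C 2)           ∎)
  where open ≤-Reasoning

∃-non-neighbour : ∀ {m} {es : List (Edge m)} {v Δ} → All Ordered es → (∀ u → incident u es ≤ Δ) →
                  incident v es ≡ Δ → suc Δ C 2 < length es → ∃ λ x → x ≢ v × edgesBetween x v es ≡ 0
∃-non-neighbour {es = es} {v} ordered d≤Δ dv≡Δ C<length
  with Fin.any? (λ x → ¬? (x Fin.≟ v) ×-dec (edgesBetween x v es ≟ 0))
... | yes (x , x≢v , x≁v) = x , x≢v , x≁v
... | no ¬∃ =
  contradiction (length≤C2 ordered d≤Δ (subst (λ d → _ ≤ suc d) dv≡Δ (vertices≤suc-deg ordered adjacent)))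
                (<⇒≱ C<length)
  where
  adjacent : ∀ x → x ≢ v → 1 ≤ edgesBetween x v es
  adjacent x x≢v = n≢0⇒n>0 (λ x≁v → ¬∃ (x , x≢v , x≁v))

module Rotation {m} {es : List (Edge m)} {a b} (s : EdgeSplit es (a , b)) {x v : Fin m}
                (x≢v : x ≢ v) (x≁v : edgesBetween x v es ≡ 0) where
  open EdgeSplit s

  private
    oriented : ∃ λ e → Ordered e × (∀ u → incidence u e ≡ incidence u (x , v))
    oriented = orient x≢v

  xv : Edge m
  xv = proj₁ oriented

  incidence-xv : ∀ u → incidence u xv ≡ incidence u (x , v)
  incidence-xv = proj₂ (proj₂ oriented)

  xv∉rest : All (xv ≢_) rest
  xv∉rest = All.tabulate λ {f} f∈rest xv≡f → contradiction (begin
    1                             ≡⟨ cong₂ _*_ (incidence-source x v) (incidence-target x v) ⟨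
    incidence x (x , v) * incidence v (x , v) ≡⟨ cong₂ _*_ (incidence-xv x) (incidence-xv v) ⟨
    incidence x xv * incidence v xv ≡⟨ cong (λ f → incidence x f * incidence v f) xv≡f ⟩
    incidence x f * incidence v f ≤⟨ ∈⇒≤edgesBetween (rest⊆ f∈rest) ⟩
    edgesBetween x v es           ≡⟨ x≁v ⟩
    0                             ∎) λ ()
    where open ≤-Reasoning

  rotated : Graph
  rotated = graph (xv ∷ rest)
                  (proj₁ (proj₂ oriented) ∷ All.tail ordered-e∷rest)
                  (xv∉rest ∷ Unique.tail unique-e∷rest)

  deg-rotated : ∀ u → deg rotated u ≡ incidence u (x , v) + incident u rest
  deg-rotated u = trans (incident-∷ u xv rest) (cong (_+ incident u rest) (incidence-xv u))

  lineCount-rotated : lineCount (edges rotated) ≡ lineCount rest + (incident x rest + incident v rest)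
  lineCount-rotated = trans (lineCount-cong (λ u → trans (deg-rotated u) (sym (incident-∷ u (x , v) rest))))
                            (lineCount-∷ rest x≢v)

rotation-improves : ∀ {N Δ} G → 1 ≤ Δ → suc Δ C 2 < N → Admissible N Δ G →
                    ∃ λ G′ → Admissible N (suc Δ) G′ × lineEdges G + 1 ≤ lineEdges G′ + 0
rotation-improves G 1≤Δ C<N (refl , refl , noIsolated)
  with v , dv≡Δ ← maxDeg-attained G 1≤Δ
  with x , x≢v , x≁v ← ∃-non-neighbour (ordered G) (deg≤maxDeg G) dv≡Δ C<N
  with e , e∈G , x∈e ← ∃-incident-edge (edges G) (noIsolated x)
  = admissible (ordered rotated) (unique rotated) (sym length≡) max≡
               (≤-trans gain (≤-reflexive (sym (+-identityʳ _))))
  where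
  s : EdgeSplit (edges G) e
  s = split e∈G (ordered G) (unique G)
  open EdgeSplit s
  open Rotation s x≢v x≁v
  Δ : ℕ
  Δ = maxDeg G
  v∉e : incidence v e ≡ 0
  v∉e = non-adjacent-edge x≁v e∈G x∈e
  dv-rest : incident v rest ≡ Δ
  dv-rest = trans (incident-rest≡ s v∉e) dv≡Δ
  deg≤suc-Δ : ∀ u → deg rotated u ≤ suc Δ
  deg≤suc-Δ u = subst (_≤ suc Δ) (sym (deg-rotated u))
                      (+-mono-≤ (incidence≤1 u (x , v)) (≤-trans (incident-rest≤ s u) (deg≤maxDeg G u)))
  max≡ : maximum (deg rotated) ≡ suc Δ
  max≡ = maximum-≡ v deg≤suc-Δ (trans (deg-rotated v) (cong₂ _+_ (incidence-target x v) dv-rest))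
  gain : lineEdges G + 1 ≤ lineCount (edges rotated)
  gain with y , y∈e , ends ← other-endpoint x∈e = begin
    lineEdges G + 1
      ≡⟨ cong (_+ 1) (trans (lineEdges≡lineCount G) (lineCount-split s)) ⟩
    lineCount rest + (incident _ rest + incident _ rest) + 1
      ≡⟨ cong (λ k → lineCount rest + k + 1) (ends (λ u → incident u rest)) ⟩
    lineCount rest + (incident x rest + incident y rest) + 1
      ≡⟨ solve 3 (λ L dx dy → L :+ (dx :+ dy) :+ con 1 := L :+ (dx :+ (con 1 :+ dy))) refl
                 (lineCount rest) (incident x rest) (incident y rest) ⟩
    lineCount rest + (incident x rest + (1 + incident y rest))
      ≤⟨ +-monoʳ-≤ (lineCount rest) (+-monoʳ-≤ (incident x rest) dy≤Δ) ⟩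
    lineCount rest + (incident x rest + incident v rest)
      ≡⟨ lineCount-rotated ⟨
    lineCount (edges rotated) ∎
    where
    open ≤-Reasoning
    dy≤Δ : 1 + incident y rest ≤ incident v rest
    dy≤Δ = subst₂ _≤_ (trans (incident≡ y) (cong (_+ incident y rest) y∈e)) (sym dv-rest) (deg≤maxDeg G y)

f[N,Δ+1]≥f[N,Δ]+1 : ∀ N Δ m m′ → 1 ≤ Δ → suc Δ C 2 < N → IsF N Δ m → IsF N (suc Δ) m′ → m′ ≥ m + 1
f[N,Δ+1]≥f[N,Δ]+1 N Δ m m′ 1≤Δ C<N isF isF′ = subst (m + 1 ≤_) (+-identityʳ m′)
  (IsF-compare 1 0 (λ G → rotation-improves G 1≤Δ C<N) isF isF′)

meets-pair≤1 : ∀ {n} {a b : Fin n} e → Ordered e → a <ᶠ b → e ≢ (a , b) →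
               incidence a e + incidence b e ≤ 1
meets-pair≤1 {a = a} {b} (c , d) c<d a<b e≢ab
  with incidence a (c , d) | incidence-view a c d | incidence b (c , d) | incidence-view b c d
... | _ | endpoint (inj₁ refl) | _ | endpoint (inj₁ refl) = contradiction refl (Fin.<⇒≢ a<b)
... | _ | endpoint (inj₁ refl) | _ | endpoint (inj₂ refl) = contradiction refl e≢ab
... | _ | endpoint (inj₂ refl) | _ | endpoint (inj₁ refl) = contradiction c<d (Fin.<-asym a<b)
... | _ | endpoint (inj₂ refl) | _ | endpoint (inj₂ refl) = contradiction refl (Fin.<⇒≢ a<b)
... | _ | endpoint _ | _ | away _ _   = ≤-refl
... | _ | away _ _   | _ | endpoint _ = ≤-refl
... | _ | away _ _   | _ | away _ _   = z≤n

three-incidences : ∀ {n} {a b : Fin n} v e → Ordered e → a <ᶠ b → e ≢ (a , b) →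
                   incidence a e + incidence b e + incidence v e ≤
                   1 + (incidence a e * incidence v e + incidence b e * incidence v e)
three-incidences {a = a} {b} v e o a<b e≢ab =
  subst (λ k → incidence a e + incidence b e + incidence v e ≤ 1 + k)
        (*-distribʳ-+ (incidence v e) (incidence a e) _)
        (s+t≤1+st (meets-pair≤1 e o a<b e≢ab) (incidence≤1 v e))
  where
  s+t≤1+st : ∀ {s t} → s ≤ 1 → t ≤ 1 → s + t ≤ 1 + s * t
  s+t≤1+st z≤n       t≤1       = t≤1
  s+t≤1+st (s≤s z≤n) z≤n       = s≤s z≤n
  s+t≤1+st (s≤s z≤n) (s≤s z≤n) = s≤s (s≤s z≤n)

incidences≤ : ∀ {n} {a b : Fin n} v {es} → a <ᶠ b → All Ordered es → All ((a , b) ≢_) es →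
              incident a es + incident b es + incident v es ≤ length es + (edgesBetween a v es + edgesBetween b v es)
incidences≤ v {[]} _ [] [] = z≤n
incidences≤ {a = a} {b} v {e ∷ es} a<b (o ∷ os) (ab≢e ∷ ab∉es) = begin
  incident a (e ∷ es) + incident b (e ∷ es) + incident v (e ∷ es)
    ≡⟨ cong₂ _+_ (cong₂ _+_ (incident-∷ a e es) (incident-∷ b e es)) (incident-∷ v e es) ⟩
  (ia + incident a es) + (ib + incident b es) + (iv + incident v es)
    ≡⟨ solve 6 (λ ia ib iv da db dv → (ia :+ da) :+ (ib :+ db) :+ (iv :+ dv)
                                     := (ia :+ ib :+ iv) :+ (da :+ db :+ dv))
               refl ia ib iv (incident a es) (incident b es) (incident v es) ⟩
  (ia + ib + iv) + (incident a es + incident b es + incident v es)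
    ≤⟨ +-mono-≤ (three-incidences v e o a<b (ab≢e ∘ sym)) (incidences≤ v a<b os ab∉es) ⟩
  (1 + (ia * iv + ib * iv)) + (length es + (edgesBetween a v es + edgesBetween b v es))
    ≡⟨ solve 5 (λ p q l x y → (con 1 :+ (p :+ q)) :+ (l :+ (x :+ y))
                              := (con 1 :+ l) :+ ((p :+ x) :+ (q :+ y)))
               refl (ia * iv) (ib * iv) (length es) (edgesBetween a v es) (edgesBetween b v es) ⟩
  length (e ∷ es) + (edgesBetween a v (e ∷ es) + edgesBetween b v (e ∷ es)) ∎
  where
  open ≤-Reasoning
  ia ib iv : ℕ
  ia = incidence a e
  ib = incidence b e
  iv = incidence v e

three-vertex-bound : ∀ {n} {a b v : Fin n} {es} → a <ᶠ b → incidence v (a , b) ≡ 0 →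
                     All Ordered es → Unique es → All ((a , b) ≢_) es →
                     incident a es + incident b es + incident v es ≤ length es + 2
three-vertex-bound {a = a} {b} {v} {es} a<b v∉ab ordered unique ab∉es
  with incidence v (a , b) | incidence-view v a b
... | _ | away v≢a v≢b = ≤-trans (incidences≤ v a<b ordered ab∉es)
  (+-monoʳ-≤ (length es) (+-mono-≤ (edgesBetween≤1 (v≢a ∘ sym) ordered unique)
                                   (edgesBetween≤1 (v≢b ∘ sym) ordered unique)))

module Reattachment {m} {es : List (Edge m)} {a b} (s : EdgeSplit es (a , b)) (v : Fin m) where
  open EdgeSplit s

  reattached : Graph
  reattached = graph ((zero , suc v) ∷ shift rest)
                     (s≤s z≤n ∷ shift-ordered (All.tail ordered-e∷rest))
                     (shift-avoids (suc v) rest ∷ shift-unique (Unique.tail unique-e∷rest))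

  numEdges-reattached : numEdges reattached ≡ length es
  numEdges-reattached = trans (cong suc (length-map _ rest)) (sym length≡)

  deg-reattached-zero : deg reattached zero ≡ 1
  deg-reattached-zero = cong suc (incident-shift-zero rest)

  deg-reattached-suc : ∀ u → deg reattached (suc u) ≡ incidence (suc u) (zero , suc v) + incident u rest
  deg-reattached-suc u = trans (incident-∷ (suc u) (zero , suc v) (shift rest)) (cong (_ +_) (incident-shift u rest))

  lineCount-reattached : lineCount (edges reattached) ≡ lineCount rest + incident v rest
  lineCount-reattached = begin
    lineCount ((zero , suc v) ∷ shift rest)
      ≡⟨ lineCount-∷ (shift rest) (λ ()) ⟩
    lineCount (shift rest) + (incident zero (shift rest) + incident (suc v) (shift rest))
      ≡⟨ cong₂ _+_ (lineCount-shift rest) (cong₂ _+_ (incident-shift-zero rest) (incident-shift v rest)) ⟩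
    lineCount rest + incident v rest ∎
    where open ≡-Reasoning

reattachment-improves : ∀ {N Δ} G → 1 ≤ Δ → Δ < N → Admissible N Δ G →
                        ∃ λ G′ → Admissible N (suc Δ) G′ × lineEdges G + (Δ + Δ) ≤ lineEdges G′ + suc N
reattachment-improves G 1≤Δ Δ<N (refl , refl , _)
  with v , dv≡Δ ← maxDeg-attained G 1≤Δ
  with (a , b) , e∈G , v∉e ← ∃-avoiding-edge (edges G) (subst (_< numEdges G) (sym dv≡Δ) Δ<N)
  = admissible (ordered reattached) (unique reattached) numEdges-reattached max≡ gain
  where
  s : EdgeSplit (edges G) (a , b)
  s = split e∈G (ordered G) (unique G)
  open EdgeSplit s
  open Reattachment s v
  Δ : ℕ
  Δ = maxDeg G
  dv-rest : incident v rest ≡ Δ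
  dv-rest = trans (incident-rest≡ s v∉e) dv≡Δ
  deg≤suc-Δ : ∀ u → deg reattached u ≤ suc Δ
  deg≤suc-Δ zero    = subst (_≤ suc Δ) (sym deg-reattached-zero) (s≤s z≤n)
  deg≤suc-Δ (suc u) = subst (_≤ suc Δ) (sym (deg-reattached-suc u))
    (+-mono-≤ (incidence≤1 (suc u) (zero , suc v)) (≤-trans (incident-rest≤ s u) (deg≤maxDeg G u)))
  max≡ : maximum (deg reattached) ≡ suc Δ
  max≡ = maximum-≡ (suc v) deg≤suc-Δ
                   (trans (deg-reattached-suc v) (cong₂ _+_ (incidence-target zero (suc v)) dv-rest))
  gain : lineEdges G + (Δ + Δ) ≤ lineCount (edges reattached) + suc (numEdges G)
  gain = begin
    lineEdges G + (Δ + Δ)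
      ≡⟨ cong (_+ (Δ + Δ)) (trans (lineEdges≡lineCount G) (lineCount-split s)) ⟩
    lineCount rest + (incident a rest + incident b rest) + (Δ + Δ)
      ≡⟨ solve 4 (λ L x y d → L :+ (x :+ y) :+ (d :+ d) := L :+ d :+ (x :+ y :+ d)) refl
                 (lineCount rest) (incident a rest) (incident b rest) Δ ⟩
    lineCount rest + Δ + (incident a rest + incident b rest + Δ)
      ≤⟨ +-monoʳ-≤ (lineCount rest + Δ) ab-bound ⟩
    lineCount rest + Δ + (length rest + 2)
      ≡⟨ cong₂ _+_ (cong (lineCount rest +_) dv-rest) (trans (cong suc length≡) (+-comm 2 (length rest))) ⟨
    lineCount rest + incident v rest + suc (numEdges G)
      ≡⟨ cong (_+ suc (numEdges G)) lineCount-reattached ⟨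
    lineCount (edges reattached) + suc (numEdges G) ∎
    where
    open ≤-Reasoning
    ab-bound : incident a rest + incident b rest + Δ ≤ length rest + 2
    ab-bound = subst (λ d → incident a rest + incident b rest + d ≤ length rest + 2) dv-rest
      (three-vertex-bound (All.head ordered-e∷rest) v∉e (All.tail ordered-e∷rest)
                          (Unique.tail unique-e∷rest) (Unique.head unique-e∷rest))

f[N,Δ+1]≥f[N,Δ] : ∀ N Δ m m′ → suc Δ ≤ N → IsF N Δ m → IsF N (suc Δ) m′ →
                (N < 2 * Δ → m′ ≥ m) × (⌈ N /2⌉ < Δ → m′ ≥ m + 1)
f[N,Δ+1]≥f[N,Δ] N zero      m m′ _   _   _    = (λ ()) , (λ ())
f[N,Δ+1]≥f[N,Δ] N Δ@(suc _) m m′ Δ<N isF isF′ = no-loss , gain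
  where
  open ≤-Reasoning
  reattach : m + (Δ + Δ) ≤ m′ + suc N
  reattach = IsF-compare (Δ + Δ) (suc N) (λ G → reattachment-improves G (s≤s z≤n) Δ<N) isF isF′
  no-loss : N < 2 * Δ → m′ ≥ m
  no-loss N<2Δ = +-cancelʳ-≤ (Δ + Δ) m m′ (begin
    m + (Δ + Δ)  ≤⟨ reattach ⟩
    m′ + suc N   ≤⟨ +-monoʳ-≤ m′ (subst (suc N ≤_) (cong (Δ +_) (+-identityʳ Δ)) N<2Δ) ⟩
    m′ + (Δ + Δ) ∎)
  gain : ⌈ N /2⌉ < Δ → m′ ≥ m + 1
  gain ⌈N/2⌉<Δ = +-cancelʳ-≤ (suc N) (m + 1) m′ (begin
    m + 1 + suc N       ≡⟨ +-assoc m 1 (suc N) ⟩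
    m + suc (suc N)     ≤⟨ +-monoʳ-≤ m N+2≤2Δ ⟩
    m + (Δ + Δ)         ≤⟨ reattach ⟩
    m′ + suc N          ∎)
    where
    c : ℕ
    c = ⌈ N /2⌉
    N+2≤2Δ : suc (suc N) ≤ Δ + Δ
    N+2≤2Δ = begin
      suc (suc N)             ≡⟨ cong (λ k → suc (suc k)) (⌊n/2⌋+⌈n/2⌉≡n N) ⟨
      suc (suc (⌊ N /2⌋ + c)) ≤⟨ s≤s (s≤s (+-monoˡ-≤ c (⌊n/2⌋≤⌈n/2⌉ N))) ⟩
      suc (suc (c + c))       ≡⟨ cong suc (+-suc c c) ⟨
      suc c + suc c           ≤⟨ +-mono-≤ ⌈N/2⌉<Δ ⌈N/2⌉<Δ ⟩
      Δ + Δ                   ∎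

mainTheorem11 : (∀ N → 1 ≤ N → IsF N 1 0)
    × (∀ N Δ m m′ → 2 ≤ Δ → Δ ≤ N → IsF N Δ m → IsF (suc N) Δ m′ → m′ ≥ m + 1)
    × (∀ N Δ m m′ → 1 ≤ Δ → (suc Δ) C 2 < N → IsF N Δ m → IsF N (suc Δ) m′ → m′ ≥ m + 1)
    × (∀ N Δ m m′ → suc Δ ≤ N → IsF N Δ m → IsF N (suc Δ) m′ →
         (N < 2 * Δ → m′ ≥ m) × (⌈ N /2⌉ < Δ → m′ ≥ m + 1))
mainTheorem11 = f[N,1]≡0 , f[N+1,Δ]≥f[N,Δ]+1 , f[N,Δ+1]≥f[N,Δ]+1 , f[N,Δ+1]≥f[N,Δ]
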